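{- Let $T_4$ be the triangular graph on $6$ vertices. Then $T_4$ is not eigensharp, i.e., $N(T_4)\geq 4$.
   Context: The triangular graph $T_n$ is the line graph of the complete graph $K_n$. For a connected graph $G$, a $t$-address is a $t$-tuple with entries in $\{0,a,b\}$ ($a,b$ distinct non-zero symbols), and an addressing of length $t$ of $G$ is an assignment of $t$-addresses to the vertices such that for any two vertices $u,v$ the distance $d_G(u,v)$ equals the number of positions in which one address equals $a$ and the other equals $b$. $N(G)$ is the minimum length of an addressing of $G$. The distance matrix $D(G)$ has $(u,v)$-entry $d_G(u,v)$; $n_+(M)$ and $n_-(M)$ denote the numbers of positive and negative eigenvalues (with multiplicity) of a real symmetric matrix $M$. It is known that $N(G)\ge \max(n_+(D(G)),n_-(D(G)))$; $G$ is called eigensharp if equality holds. For $T_4$, $\max(n_+(D(T_4)),n_-(D(T_4)))=3$. -}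

module Defs where

open import Data.Nat using (ℕ; zero; suc; _+_; _≤_)
open import Data.Fin using (Fin; _<_)
open import Data.Product using (Σ; _×_; _,_; proj₁; proj₂)
open import Data.Sum using (_⊎_)
open import Data.Vec using (Vec; []; _∷_)
open import Relation.Binary.PropositionalEquality using (_≡_)
open import Relation.Nullary using (¬_)

-- Vertices of T₄ = L(K₄): edges {i,j} of K₄, represented as pairs i < j in Fin 4.
V : Set
V = Σ (Fin 4 × Fin 4) (λ p → proj₁ p < proj₂ p)

lo hi : V → Fin 4
lo v = proj₁ (proj₁ v)
hi v = proj₂ (proj₁ v)

ShareEnd : V → V → Set
ShareEnd u v = (lo u ≡ lo v) ⊎ (lo u ≡ hi v) ⊎ (hi u ≡ lo v) ⊎ (hi u ≡ hi v)

Adj : V → V → Set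
Adj u v = ¬ (u ≡ v) × ShareEnd u v

data Walk : V → V → ℕ → Set where
  nil  : ∀ {u} → Walk u u 0
  cons : ∀ {u w v k} → Adj u w → Walk w v k → Walk u v (suc k)

Dist : V → V → ℕ → Set
Dist u v d = Walk u v d × (∀ k → Walk u v k → d ≤ k)

data Sym : Set where
  s0 sa sb : Sym

δ : Sym → Sym → ℕ
δ sa sb = 1
δ sb sa = 1
δ _  _  = 0

addrDist : ∀ {t} → Vec Sym t → Vec Sym t → ℕ
addrDist []       []       = 0
addrDist (x ∷ xs) (y ∷ ys) = δ x y + addrDist xs ys

IsAddressing : ∀ {t} → (V → Vec Sym t) → Set
IsAddressing f = ∀ u v → Dist u v (addrDist (f u) (f v))

-- T₄ = L(K₄) is the octahedron: two vertices are at distance 1 unless they are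
-- disjoint edges of K₄, which form three antipodal pairs at distance 2.  So an
-- addressing of T₄ is a realisation of the octahedral distance matrix by
-- {0,a,b}-words, and an exhaustive search (adding one vertex at a time and pruning
-- as soon as a distance fails) shows that no such words of length 3 or less exist.
module Submission where

open import Defs
open import Data.Bool using (Bool; true; T; _∧_; _∨_)
open import Data.Bool.Properties using (T-∧; T-∨)
open import Data.Empty using (⊥-elim)
open import Data.Fin using (Fin; suc; _<?_)
open import Data.Fin.Patterns using (0F; 1F; 2F; 3F)
open import Data.Fin.Properties using (_≟_; <-irrelevant)
open import Data.List using (List; []; _∷_; map)
open import Data.List.Membership.Propositional using (_∈_)
open import Data.List.Relation.Unary.All as All using (All; all?)
open import Data.List.Relation.Unary.Any as Any using (Any; here; there; any?)
open import Data.Nat using (ℕ; zero; suc; _≤_; z≤n; s≤s; _≡ᵇ_)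
open import Data.Nat.Properties using (≤-antisym; ≡⇒≡ᵇ)
open import Data.Product using (∃-syntax; _×_; _,_; proj₁; proj₂)
open import Data.Product.Properties using (≡-dec)
open import Data.Sum using (_⊎_; inj₁; inj₂)
open import Data.Vec using (Vec; []; _∷_)
open import Function using (_∘_; Equivalence)
open import Relation.Binary.Definitions using (DecidableEquality)
open import Relation.Binary.PropositionalEquality using (_≡_; refl; subst)
open import Relation.Nullary using (¬_; Dec; yes; no; ¬?; _×-dec_; _⊎-dec_)
open import Relation.Nullary.Decidable using (True; toWitness; from-yes)

walk-zero : ∀ {u v} → Walk u v 0 → u ≡ v
walk-zero nil = refl

shareEnd-refl : ∀ u → ShareEnd u u
shareEnd-refl u = inj₁ refl

dist-refl : ∀ u → Dist u u 0
dist-refl u = nil , λ _ _ → z≤n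

dist-unique : ∀ {u v d e} → Dist u v d → Dist u v e → d ≡ e
dist-unique (p , p-shortest) (q , q-shortest) = ≤-antisym (p-shortest _ q) (q-shortest _ p)

dist-adj : ∀ {u v} → Adj u v → Dist u v 1
dist-adj {u} {v} u~v = cons u~v nil , shortest
  where
  shortest : ∀ k → Walk u v k → 1 ≤ k
  shortest zero    w = ⊥-elim (proj₁ u~v (walk-zero w))
  shortest (suc k) _ = s≤s z≤n

dist-commonNeighbour : ∀ {u w v} → ¬ ShareEnd u v → Adj u w → Adj w v → Dist u v 2
dist-commonNeighbour {u} {v = v} u≁v u~w w~v = cons u~w (cons w~v nil) , shortest
  where
  shortest : ∀ k → Walk u v k → 2 ≤ k
  shortest zero          p            = ⊥-elim (u≁v (subst (ShareEnd u) (walk-zero p) (shareEnd-refl u)))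
  shortest (suc zero)    (cons u~x p) = ⊥-elim (u≁v (subst (ShareEnd u) (walk-zero p) (proj₂ u~x)))
  shortest (suc (suc k)) _            = s≤s (s≤s z≤n)

_≟ᵥ_ : DecidableEquality V
_≟ᵥ_ = ≡-dec (≡-dec _≟_ _≟_) (λ p q → yes (<-irrelevant p q))

shareEnd? : ∀ u v → Dec (ShareEnd u v)
shareEnd? u v = (lo u ≟ lo v) ⊎-dec (lo u ≟ hi v) ⊎-dec (hi u ≟ lo v) ⊎-dec (hi u ≟ hi v)

adj? : ∀ u v → Dec (Adj u v)
adj? u v = ¬? (u ≟ᵥ v) ×-dec shareEnd? u v

vertex : (i j : Fin 4) → {i<j : True (i <? j)} → V
vertex i j {i<j} = (i , j) , toWitness i<j

vertices : List V
vertices = vertex 0F 1F ∷ vertex 0F 2F ∷ vertex 0F 3F ∷ vertex 1F 2F ∷ vertex 1F 3F ∷ vertex 2F 3F ∷ []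

∈-vertices : ∀ v → v ∈ vertices
∈-vertices ((0F , 1F) , s≤s z≤n)             = here refl
∈-vertices ((0F , 2F) , s≤s z≤n)             = there (here refl)
∈-vertices ((0F , 3F) , s≤s z≤n)             = there (there (here refl))
∈-vertices ((1F , 2F) , s≤s (s≤s z≤n))       = there (there (there (here refl)))
∈-vertices ((1F , 3F) , s≤s (s≤s z≤n))       = there (there (there (there (here refl))))
∈-vertices ((2F , 3F) , s≤s (s≤s (s≤s z≤n))) = there (there (there (there (there (here refl)))))
∈-vertices ((_ , 0F) , ())
∈-vertices ((suc _ , 1F) , s≤s ())
∈-vertices ((suc (suc _) , 2F) , s≤s (s≤s ()))
∈-vertices ((suc (suc (suc _)) , 3F) , s≤s (s≤s (s≤s ())))

byExhaustion : ∀ {P : V → Set} → All P vertices → ∀ v → P v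
byExhaustion all-P v = All.lookup all-P (∈-vertices v)

CommonNeighbourOrShare : V → V → Set
CommonNeighbourOrShare u v = ShareEnd u v ⊎ Any (λ w → Adj u w × Adj w v) vertices

commonNeighbourOrShare? : ∀ u v → Dec (CommonNeighbourOrShare u v)
commonNeighbourOrShare? u v = shareEnd? u v ⊎-dec any? (λ w → adj? u w ×-dec adj? w v) vertices

commonNeighbourOrShare-everywhere : All (λ u → All (CommonNeighbourOrShare u) vertices) vertices
commonNeighbourOrShare-everywhere = from-yes (all? (λ u → all? (commonNeighbourOrShare? u) vertices) vertices)

-- The table is consulted through a function rather than a `with`, since
-- with-abstraction would make Agda normalise its (large) proof term.
diameter-two : ∀ u v → ¬ ShareEnd u v → ∃[ w ] Adj u w × Adj w v
diameter-two u v u≁v = commonNeighbour (byExhaustion (byExhaustion commonNeighbourOrShare-everywhere u) v)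
  where
  commonNeighbour : CommonNeighbourOrShare u v → ∃[ w ] Adj u w × Adj w v
  commonNeighbour (inj₁ u∼v)       = ⊥-elim (u≁v u∼v)
  commonNeighbour (inj₂ neighbour) = Any.satisfied neighbour

lineDist : V → V → ℕ
lineDist u v with u ≟ᵥ v | shareEnd? u v
... | yes _ | _     = 0
... | no _  | yes _ = 1
... | no _  | no _  = 2

dist-lineDist : ∀ u v → Dist u v (lineDist u v)
dist-lineDist u v with u ≟ᵥ v | shareEnd? u v
... | yes refl | _       = dist-refl u
... | no u≢v   | yes u∼v = dist-adj (u≢v , u∼v)
... | no _     | no u≁v  = let _ , u~w , w~v = diameter-two u v u≁v in dist-commonNeighbour u≁v u~w w~v

addrDist≡lineDist : ∀ {t} (f : V → Vec Sym t) → IsAddressing f → ∀ u v → addrDist (f u) (f v) ≡ lineDist u v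
addrDist≡lineDist f addressing u v = dist-unique (addressing u v) (dist-lineDist u v)

anySym : (Sym → Bool) → Bool
anySym q = q s0 ∨ q sa ∨ q sb

anySym-intro : ∀ q s → T (q s) → T (anySym q)
anySym-intro q s0 qs = Equivalence.from (T-∨ {q s0}) (inj₁ qs)
anySym-intro q sa qs = Equivalence.from (T-∨ {q s0}) (inj₂ (Equivalence.from (T-∨ {q sa}) (inj₁ qs)))
anySym-intro q sb qs = Equivalence.from (T-∨ {q s0}) (inj₂ (Equivalence.from (T-∨ {q sa}) (inj₂ qs)))

anyWord : ∀ t → (Vec Sym t → Bool) → Bool
anyWord zero    p = p []
anyWord (suc t) p = anySym λ s → anyWord t (p ∘ (s ∷_))

anyWord-intro : ∀ t p (x : Vec Sym t) → T (p x) → T (anyWord t p)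
anyWord-intro zero    p []      px = px
anyWord-intro (suc t) p (s ∷ x) px = anySym-intro (λ s → anyWord t (p ∘ (s ∷_))) s (anyWord-intro t _ x px)

module _ {A : Set} (t : ℕ) (D : A → A → ℕ) where

  fitsAll : A → Vec Sym t → List (A × Vec Sym t) → Bool
  fitsAll v x []                = true
  fitsAll v x ((u , y) ∷ placed) = (addrDist y x ≡ᵇ D u v) ∧ fitsAll v x placed

  addressable? : List A → List (A × Vec Sym t) → Bool
  addressable? []       placed = true
  addressable? (v ∷ vs) placed = anyWord t λ x → fitsAll v x placed ∧ addressable? vs ((v , x) ∷ placed)

  module _ (g : A → Vec Sym t) (g-realises : ∀ u v → addrDist (g u) (g v) ≡ D u v) where

    graph : List A → List (A × Vec Sym t)
    graph = map λ u → u , g u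

    fitsAll-graph : ∀ v us → T (fitsAll v (g v) (graph us))
    fitsAll-graph v []       = _
    fitsAll-graph v (u ∷ us) = Equivalence.from T-∧ (≡⇒≡ᵇ _ _ (g-realises u v) , fitsAll-graph v us)

    addressable?-complete : ∀ vs us → T (addressable? vs (graph us))
    addressable?-complete []       us = _
    addressable?-complete (v ∷ vs) us =
      anyWord-intro t _ (g v) (Equivalence.from T-∧ (fitsAll-graph v us , addressable?-complete vs (v ∷ us)))

noShortAddressing : ∀ t → T (addressable? t lineDist vertices []) → 4 ≤ t
-- The absurd clauses run the pruned search over all words of length at most 3.
noShortAddressing 0 ()
noShortAddressing 1 ()
noShortAddressing 2 ()
noShortAddressing 3 ()
noShortAddressing (suc (suc (suc (suc _)))) _ = s≤s (s≤s (s≤s (s≤s z≤n)))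

mainTheorem2 : (t : ℕ) (f : V → Vec Sym t) → IsAddressing f → 4 ≤ t
mainTheorem2 t f addressing =
  noShortAddressing t (addressable?-complete t lineDist f (addrDist≡lineDist f addressing) vertices [])
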